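{- For integers $2\leq m\leq n$, $\gamma_{P,c}(K_m\,\square\,K_n)=m-1$.
   Context: Power domination: for $S\subseteq V(G)$, start with $M(S)=N[S]$ and repeatedly add a vertex $w$ whenever some $v\in M(S)$ has $w$ as its unique neighbour outside $M(S)$; $S$ is a connected power dominating set if the final $M(S)$ is $V(G)$ and $\langle S\rangle$ is connected; $\gamma_{P,c}(G)$ is the minimum size of such a set. The Cartesian product $G\,\square\,H$ has vertex set $V(G)\times V(H)$, with $(a,b)\sim(x,y)$ iff either $a=x$ and $by\in E(H)$, or $b=y$ and $ax\in E(G)$. $K_n$ is the complete graph on $n$ vertices. -}

module Defs where

open import Data.Nat using (ℕ)
open import Data.Fin using (Fin)
open import Data.Product using (_×_; proj₁; proj₂; Σ; _,_)
open import Data.Sum using (_⊎_)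
open import Data.List using (List; length)
open import Data.List.Membership.Propositional using (_∈_)
open import Data.List.Relation.Unary.Unique.Propositional using (Unique)
open import Relation.Binary.PropositionalEquality using (_≡_; _≢_)

-- Cartesian product K_m □ K_n on vertex set Fin m × Fin n:
-- (a,b) ~ (x,y) iff (a = x and b ~ y in K_n, i.e. b ≠ y)
--                 or (b = y and a ~ x in K_m, i.e. a ≠ x).
KmKnAdj : (m n : ℕ) → Fin m × Fin n → Fin m × Fin n → Set
KmKnAdj m n (a , b) (x , y) = (a ≡ x × b ≢ y) ⊎ (b ≡ y × a ≢ x)

-- Final monitored set M(S) of the power domination process, as the least
-- set containing N[S] and closed under the propagation rule:
-- if v is monitored, w is a neighbour of v, and every neighbour u ≠ w of v
-- is monitored (w is the unique unmonitored neighbour), then w is monitored.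
data Monitored {V : Set} (Adj : V → V → Set) (S : List V) : V → Set where
  inS  : ∀ {v} → v ∈ S → Monitored Adj S v
  nbrS : ∀ {v w} → v ∈ S → Adj v w → Monitored Adj S w
  prop : ∀ {v w} → Monitored Adj S v → Adj v w →
         (∀ u → Adj v u → u ≢ w → Monitored Adj S u) → Monitored Adj S w

data WalkIn {V : Set} (Adj : V → V → Set) (S : List V) : V → V → Set where
  here : ∀ {x} → x ∈ S → WalkIn Adj S x x
  step : ∀ {x y z} → x ∈ S → Adj x y → WalkIn Adj S y z → WalkIn Adj S x z

InducedConnected : {V : Set} (Adj : V → V → Set) (S : List V) → Set
InducedConnected Adj S = ∀ {x y} → x ∈ S → y ∈ S → WalkIn Adj S x y

-- S (a duplicate-free list, i.e. a finite vertex set) is a connected power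
-- dominating set.
IsCPDS : {V : Set} (Adj : V → V → Set) (S : List V) → Set
IsCPDS Adj S = Unique S × (∀ v → Monitored Adj S v) × InducedConnected Adj S

ConnPowerDomNumber : {V : Set} (Adj : V → V → Set) → ℕ → Set
ConnPowerDomNumber {V} Adj k =
  (Σ (List V) λ S → IsCPDS Adj S × length S ≡ k) ×
  (∀ (S : List V) → IsCPDS Adj S → k Data.Nat.≤ length S)

{-# OPTIONS --safe #-}
module Submission where

-- Upper bound: in K_(k+2) □ K_n, the column-0 vertices of all rows but row 0
-- form a clique dominating every row except row 0; (0,0) is dominated, and
-- each (0,b) with b ≠ 0 is the only unmonitored neighbour of (1,b).
-- Lower bound: if |S| ≤ m − 2 ≤ n − 2, then at least two rows and two columns
-- avoid S. Call a vertex covered if its row or column meets S. A covered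
-- vertex with an uncovered neighbour w has a second uncovered neighbour
-- (switch w's free column, or free row, for another free one), so propagation
-- never leaves the covered vertices and the vertex at a free row and a free
-- column is never monitored.

open import Defs
open import Data.Nat using (ℕ; zero; suc; _≤_; _<_; _∸_; _+_; s≤s; z≤n; _≤?_)
open import Data.Nat.Properties using (≰⇒>; ≤-trans; n≤1+n)
open import Data.Fin using (Fin; zero; suc)
open import Data.Fin.Properties using (_≟_; pigeonhole; ¬∀⟶∃¬; <⇒≢; suc-injective)
open import Data.Product using (_×_; _,_; proj₁; proj₂; ∃)
open import Data.Sum using (_⊎_; inj₁; inj₂)
open import Data.List using (List; _∷_; length; map; lookup; allFin)
open import Data.List.Properties using (length-map; length-tabulate)
open import Data.List.Membership.Propositional using (_∈_; _∉_)
open import Data.List.Membership.Propositional.Properties using (∈-map⁺; ∈-map⁻; ∈-allFin)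
open import Data.List.Relation.Unary.Any using (here; there; index; any?)
open import Data.List.Relation.Unary.Any.Properties using (lookup-index)
open import Data.List.Relation.Unary.Unique.Propositional using (Unique)
open import Data.List.Relation.Unary.Unique.Propositional.Properties using (allFin⁺; map⁺)
open import Data.Empty using (⊥-elim)
open import Function using (_∘_; id)
open import Relation.Nullary using (¬_; Dec; yes; no; _⊎-dec_)
open import Relation.Binary.PropositionalEquality using (_≡_; _≢_; refl; sym; trans; cong; subst; module ≡-Reasoning)

¬all-∈-short : ∀ {m} (L : List (Fin m)) → length L < m → ¬ (∀ a → a ∈ L)
¬all-∈-short L |L|<m all-∈ with pigeonhole |L|<m (index ∘ all-∈)
... | i , j , i<j , same-index = <⇒≢ i<j (begin
  i                          ≡⟨ lookup-index (all-∈ i) ⟩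
  lookup L (index (all-∈ i)) ≡⟨ cong (lookup L) same-index ⟩
  lookup L (index (all-∈ j)) ≡⟨ sym (lookup-index (all-∈ j)) ⟩
  j                          ∎)
  where open ≡-Reasoning

∃∉-short : ∀ {m} (L : List (Fin m)) → length L < m → ∃ λ a → a ∉ L
∃∉-short L |L|<m = ¬∀⟶∃¬ _ (_∈ L) (λ a → any? (a ≟_) L) (¬all-∈-short L |L|<m)

∃∉-avoiding : ∀ {m} (L : List (Fin m)) → 2 + length L ≤ m → ∀ y → ∃ λ c → c ∉ L × c ≢ y
∃∉-avoiding L 2+|L|≤m y with ∃∉-short (y ∷ L) 2+|L|≤m
... | c , c∉y∷L = c , c∉y∷L ∘ there , c∉y∷L ∘ here

module LowerBound {m n : ℕ} (S : List (Fin m × Fin n))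
                  (2+|S|≤m : 2 + length S ≤ m) (2+|S|≤n : 2 + length S ≤ n) where

  rows : List (Fin m)
  rows = map proj₁ S

  cols : List (Fin n)
  cols = map proj₂ S

  2+|rows|≤m : 2 + length rows ≤ m
  2+|rows|≤m = subst (λ l → 2 + l ≤ m) (sym (length-map proj₁ S)) 2+|S|≤m

  2+|cols|≤n : 2 + length cols ≤ n
  2+|cols|≤n = subst (λ l → 2 + l ≤ n) (sym (length-map proj₂ S)) 2+|S|≤n

  Covered : Fin m × Fin n → Set
  Covered (x , y) = x ∈ rows ⊎ y ∈ cols

  covered? : ∀ v → Dec (Covered v)
  covered? (x , y) = any? (x ≟_) rows ⊎-dec any? (y ≟_) cols

  other-uncovered-neighbour : ∀ {v w} → Covered v → KmKnAdj m n v w → ¬ Covered w →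
                              ∃ λ u → KmKnAdj m n v u × u ≢ w × ¬ Covered u
  other-uncovered-neighbour {x , b} {.x , y} (inj₁ x∈) (inj₁ (refl , _)) ¬cw = ⊥-elim (¬cw (inj₁ x∈))
  other-uncovered-neighbour {x , b} {.x , y} (inj₂ b∈) (inj₁ (refl , _)) ¬cw
    with c , c∉ , c≢y ← ∃∉-avoiding cols 2+|cols|≤n y
    = (x , c) , inj₁ (refl , (λ b≡c → c∉ (subst (_∈ cols) b≡c b∈)))
    , c≢y ∘ cong proj₂ , λ { (inj₁ x∈) → ¬cw (inj₁ x∈) ; (inj₂ c∈) → c∉ c∈ }
  other-uncovered-neighbour {a , y} {x , .y} (inj₂ y∈) (inj₂ (refl , _)) ¬cw = ⊥-elim (¬cw (inj₂ y∈))
  other-uncovered-neighbour {a , y} {x , .y} (inj₁ a∈) (inj₂ (refl , _)) ¬cw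
    with c , c∉ , c≢x ← ∃∉-avoiding rows 2+|rows|≤m x
    = (c , y) , inj₂ (refl , (λ a≡c → c∉ (subst (_∈ rows) a≡c a∈)))
    , c≢x ∘ cong proj₁ , λ { (inj₁ c∈) → c∉ c∈ ; (inj₂ y∈) → ¬cw (inj₂ y∈) }

  monitored⇒covered : ∀ {v} → Monitored (KmKnAdj m n) S v → Covered v
  monitored⇒covered (inS v∈S) = inj₁ (∈-map⁺ proj₁ v∈S)
  monitored⇒covered (nbrS v∈S (inj₁ (refl , _))) = inj₁ (∈-map⁺ proj₁ v∈S)
  monitored⇒covered (nbrS v∈S (inj₂ (refl , _))) = inj₂ (∈-map⁺ proj₂ v∈S)
  monitored⇒covered {w} (prop mv vw others-monitored) with covered? w
  ... | yes cw = cw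
  ... | no ¬cw with u , vu , u≢w , ¬cu ← other-uncovered-neighbour (monitored⇒covered mv) vw ¬cw
    = ⊥-elim (¬cu (monitored⇒covered (others-monitored u vu u≢w)))

  ¬all-monitored : ¬ (∀ v → Monitored (KmKnAdj m n) S v)
  ¬all-monitored all-monitored
    with x , x∉ ← ∃∉-short rows (≤-trans (n≤1+n _) 2+|rows|≤m)
       | y , y∉ ← ∃∉-short cols (≤-trans (n≤1+n _) 2+|cols|≤n)
    with monitored⇒covered (all-monitored (x , y))
  ... | inj₁ x∈ = x∉ x∈
  ... | inj₂ y∈ = y∉ y∈

power-dominating-size : ∀ {m n} → m ≤ n → (S : List (Fin m × Fin n)) →
                        (∀ v → Monitored (KmKnAdj m n) S v) → m ∸ 1 ≤ length S
power-dominating-size {zero} _ _ _ = z≤n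
power-dominating-size {suc m} {n} m≤n S all-monitored with m ≤? length S
... | yes m≤|S| = m≤|S|
... | no m≰|S| = ⊥-elim (LowerBound.¬all-monitored S 2+|S|≤m (≤-trans 2+|S|≤m m≤n) all-monitored)
  where
  2+|S|≤m : 2 + length S ≤ suc m
  2+|S|≤m = s≤s (≰⇒> m≰|S|)

module UpperBound (k n : ℕ) where

  G : Fin (2 + k) × Fin (suc n) → Fin (2 + k) × Fin (suc n) → Set
  G = KmKnAdj (2 + k) (suc n)

  S : List (Fin (2 + k) × Fin (suc n))
  S = map (λ i → (suc i , zero)) (allFin (suc k))

  length-S : length S ≡ suc k
  length-S = trans (length-map _ (allFin (suc k))) (length-tabulate id)

  unique-S : Unique S
  unique-S = map⁺ (suc-injective ∘ cong proj₁) (allFin⁺ (suc k))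

  ∈S : ∀ i → (suc i , zero) ∈ S
  ∈S i = ∈-map⁺ _ (∈-allFin i)

  monitored-suc : ∀ i b → Monitored G S (suc i , b)
  monitored-suc i zero = inS (∈S i)
  monitored-suc i (suc b) = nbrS (∈S i) (inj₁ (refl , λ ()))

  all-monitored : ∀ v → Monitored G S v
  all-monitored (suc i , b) = monitored-suc i b
  all-monitored (zero , zero) = nbrS (∈S zero) (inj₂ (refl , λ ()))
  all-monitored (zero , suc b) = prop (monitored-suc zero (suc b)) (inj₂ (refl , λ ())) others
    where
    others : ∀ u → G (suc zero , suc b) u → u ≢ (zero , suc b) → Monitored G S u
    others (suc j , y) _ _ = monitored-suc j y
    others (zero , .(suc b)) (inj₂ (refl , _)) u≢w = ⊥-elim (u≢w refl)

  connected : InducedConnected G S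
  connected x∈S y∈S with ∈-map⁻ _ x∈S | ∈-map⁻ _ y∈S
  ... | i , _ , refl | j , _ , refl with i ≟ j
  ... | yes refl = here x∈S
  ... | no i≢j = step x∈S (inj₂ (refl , i≢j ∘ suc-injective)) (here y∈S)

  cpds : IsCPDS G S
  cpds = unique-S , all-monitored , connected

theorem5 : (m n : ℕ) → 2 ≤ m → m ≤ n → ConnPowerDomNumber (KmKnAdj m n) (m ∸ 1)
theorem5 (suc (suc k)) (suc n) (s≤s (s≤s z≤n)) m≤n =
  (S , cpds , length-S) , λ S′ (_ , all-monitored′ , _) → power-dominating-size m≤n S′ all-monitored′
  where open UpperBound k n
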